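{- Let $G$ be a $5$-odd-connected graph, let $v$ be a vertex of degree four and let $v_1,v_2,v_3,v_4$ be its four neighbors. Then the graph $G.v_1vv_2$ or the graph $G.v_2vv_3$ is also $5$-odd-connected.
   Context: Graphs may have loops and parallel edges. For a partition $(A,B)$ of the vertex set, the edge-cut $E(A,B)$ is the set of edges with one end in $A$ and the other in $B$. A graph is $5$-odd-connected if it has no edge-cut of odd size less than $5$ (i.e., of size $1$ or $3$). Splitting: for a vertex $v$ and neighbors $v_1,v_2$ of $v$, the graph $G.v_1vv_2$ is obtained by removing the edges $vv_1$ and $vv_2$ and adding a new vertex joined by one edge to $v_1$ and one edge to $v_2$ (with the natural conventions for loops: if $vv_1$ is a loop, the loop is removed and $vv_2$ is subdivided, and symmetrically; if both are loops, they are removed and a new vertex joined to $v$ by two parallel edges is added). -}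

module Defs where

open import Data.Nat using (ℕ; suc; _≤_; _%_)
open import Data.Bool using (Bool; true; false; not; if_then_else_; _∧_; _∨_)
open import Data.Fin using (Fin; fromℕ; inject₁; _≟_)
open import Data.Product using (_×_; _,_; proj₁; proj₂)
open import Data.List using (List; []; _∷_; _++_; length; lookup; allFin; map; filterᵇ; cartesianProduct)
open import Relation.Nullary.Decidable using (⌊_⌋)
open import Relation.Binary.PropositionalEquality using (_≡_)

-- A finite multigraph (loops and parallel edges allowed): vertices Fin n,
-- edges a list of (unordered) pairs of end vertices; a loop is a pair (u , u),
-- parallel edges are repeated entries.
record Graph : Set where
  constructor graph
  field
    n     : ℕ
    edges : List (Fin n × Fin n)

open Graph public

EdgeIx : Graph → Set
EdgeIx G = Fin (length (edges G))

-- A half-edge: an edge together with a choice of one of its two ends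
-- (a loop has two distinct half-edges at its vertex).
HalfEdge : Graph → Set
HalfEdge G = EdgeIx G × Bool

allHalfEdges : (G : Graph) → List (HalfEdge G)
allHalfEdges G = cartesianProduct (allFin (length (edges G))) (true ∷ false ∷ [])

end : (G : Graph) → HalfEdge G → Fin (n G)
end G (e , true)  = proj₁ (lookup (edges G) e)
end G (e , false) = proj₂ (lookup (edges G) e)

other : (G : Graph) → HalfEdge G → Fin (n G)
other G (e , b) = end G (e , not b)

-- degree = number of half-edges at v (loops count twice)
degree : (G : Graph) → Fin (n G) → ℕ
degree G v = length (filterᵇ (λ h → ⌊ end G h ≟ v ⌋) (allHalfEdges G))

-- A vertex partition (A , B) is given by its indicator A : vertex → Bool
-- (B is the complement). Size of the edge-cut E(A,B):
crosses : {k : ℕ} → (Fin k → Bool) → Fin k × Fin k → Bool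
crosses A (x , y) = (A x ∧ not (A y)) ∨ (not (A x) ∧ A y)

cutSize : (G : Graph) → (Fin (n G) → Bool) → ℕ
cutSize G A = length (filterᵇ (crosses A) (edges G))

FiveOddConnected : Graph → Set
FiveOddConnected G = (A : Fin (n G) → Bool) → cutSize G A % 2 ≡ 1 → 5 ≤ cutSize G A

-- Splitting G.v₁vv₂ along two distinct half-edges h₁ , h₂ at v (with other ends
-- v₁ , v₂): remove the edges of h₁ and h₂, add a new vertex w joined by one
-- edge to v₁ and one edge to v₂. This uniformly covers the loop conventions.
split : (G : Graph) → HalfEdge G → HalfEdge G → Graph
split G h₁ h₂ = graph (suc (n G)) (kept ++ ((w , inject₁ (other G h₁)) ∷ (w , inject₁ (other G h₂)) ∷ []))
  where
  w : Fin (suc (n G))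
  w = fromℕ (n G)
  keep : EdgeIx G → Bool
  keep i = not (⌊ i ≟ proj₁ h₁ ⌋ ∨ ⌊ i ≟ proj₁ h₂ ⌋)
  lift : EdgeIx G → Fin (suc (n G)) × Fin (suc (n G))
  lift i = inject₁ (proj₁ (lookup (edges G) i)) , inject₁ (proj₂ (lookup (edges G) i))
  kept : List (Fin (suc (n G)) × Fin (suc (n G)))
  kept = map lift (filterᵇ keep (allFin (length (edges G))))

module Submission where

-- Let v have degree 4 with half-edges h₀ … h₃ and other ends v₀ … v₃.  Call a
-- vertex set X tight for (v; vᵢ, vⱼ) if |δ(X)| = 5, v ∉ X and vᵢ, vⱼ ∈ X.
--
--  (A) [split-preserves] If no set is tight for (v; v₁, v₂), then G.v₁vv₂ is
--      5-odd-connected: a cut of the split graph agrees with a cut of G except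
--      on the two new edges, and turning both of them around changes the size
--      by -2, 0 or +2; the only dangerous case (-2 from size 5) is a tight set.
--  (B) [no-consecutive-tight] Sets X tight for (v; v₀, v₁) and Y tight for
--      (v; v₁, v₂) cannot coexist.  Uncrossing gives d(X ∩ Y) + d(X ∪ Y) ≤ 10
--      and d(X ∖ Y) + d(Y ∖ X) < 10 (the edge of h₁ joins X ∩ Y to the
--      complement of X ∪ Y).  If d(X ∩ Y) is even, then d(X ∖ Y) and d(Y ∖ X) are
--      odd, hence ≥ 5, a contradiction; if it is odd, then d(X ∪ Y) ≤ 5 is odd,
--      and adding v, which sends three edges into X ∪ Y, yields an odd cut of
--      size ≤ 3.
-- Tightness is decidable (finitely many vertex sets), so either no set is tight
-- for (v; v₀, v₁), or by (B) none is tight for (v; v₁, v₂); (A) finishes.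

open import Defs
open import Data.Bool using (Bool; true; false; not; if_then_else_; _∧_; _∨_; T)
open import Data.Bool.Properties using (T-∧; ∧-comm; ∨-zeroʳ; ∨-identityʳ; ¬-not; not-involutive)
import Data.Bool.Properties as Bool
open import Data.Empty using (⊥)
open import Data.Fin using (Fin; zero; suc; inject₁; fromℕ; _≟_)
open import Data.Fin.Subset.Properties using (anySubset?)
open import Data.List using (List; []; _∷_; _++_; length; lookup; map; filterᵇ; tabulate; cartesianProduct; allFin)
open import Data.List.Properties using (filter-++; length-++; tabulate-lookup)
open import Data.Nat using (ℕ; zero; suc; _+_; _*_; _≤_; _%_; _≡ᵇ_; z≤n; s≤s)
import Data.Nat as ℕ
open import Data.Nat.DivMod using ([m+kn]%n≡m%n; %-distribˡ-+; m%n<n)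
open import Data.Nat.Properties
  using (+-*-semiring; ≡ᵇ⇒≡; +-assoc; +-comm; +-identityʳ; +-mono-≤; +-monoʳ-≤; +-monoˡ-≤; +-cancelˡ-≤; +-cancelʳ-≤;
         ≤-refl; ≤-trans; ≤-reflexive; m≤m+n; *-comm; *-monoʳ-≤; ≤∧≢⇒<; 1+n≰n; n≤1+n; module ≤-Reasoning)
open import Data.Product using (Σ; _×_; _,_; proj₁; proj₂)
open import Data.Sum using (_⊎_; inj₁; inj₂)
open import Data.Unit using (tt)
open import Data.Vec.Properties using (lookup∘tabulate)
import Data.Vec as Vec
open import Function using (_∘_; case_of_)
open import Function.Bundles using (Equivalence)
open import Function.Definitions using (Injective)
open import Relation.Nullary using (¬_; Dec; yes; no; does; contradiction)
open import Relation.Nullary.Decidable using (⌊_⌋; T?; _×-dec_)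
open import Relation.Binary.PropositionalEquality
  using (_≡_; _≢_; refl; sym; trans; cong; cong₂; subst; module ≡-Reasoning)
open import Algebra.Properties.Semiring.Sum +-*-semiring
  using (sum; sum-cong-≗; ∑-distrib-+; *-distribˡ-sum; sum-replicate-zero)

private
  variable
    m k : ℕ
    P Q : Set

𝟙 : Bool → ℕ
𝟙 true  = 1
𝟙 false = 0

VSet : ℕ → Set
VSet k = Fin k → Bool

infixr 7 _∩_ _∖_
infixr 6 _∪_

_∩_ _∪_ _∖_ : VSet k → VSet k → VSet k
(S ∩ T) u = S u ∧ T u
(S ∪ T) u = S u ∨ T u
(S ∖ T) u = S u ∧ not (T u)

∁ : VSet k → VSet k
∁ S u = not (S u)

⟨_⟩ : Fin k → VSet k
⟨ v ⟩ u = ⌊ u ≟ v ⌋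

-- "the two ends lie on different sides"; crosses A (x , y) unfolds to A x ≠ᵇ A y
_≠ᵇ_ : Bool → Bool → Bool
a ≠ᵇ b = (a ∧ not b) ∨ (not a ∧ b)

≠ᵇ-sym : ∀ a b → a ≠ᵇ b ≡ b ≠ᵇ a
≠ᵇ-sym false false = refl
≠ᵇ-sym false true  = refl
≠ᵇ-sym true  false = refl
≠ᵇ-sym true  true  = refl

≠ᵇ-self : ∀ a → a ≠ᵇ a ≡ false
≠ᵇ-self false = refl
≠ᵇ-self true  = refl

≠ᵇ-notˡ : ∀ a b → not a ≠ᵇ b ≡ not (a ≠ᵇ b)
≠ᵇ-notˡ false b = ∨-identityʳ (not b)
≠ᵇ-notˡ true  b = sym (trans (cong not (∨-identityʳ (not b))) (not-involutive b))

≠ᵇ-not : ∀ a b → not a ≠ᵇ not b ≡ a ≠ᵇ b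
≠ᵇ-not false false = refl
≠ᵇ-not false true  = refl
≠ᵇ-not true  false = refl
≠ᵇ-not true  true  = refl

links : VSet k → VSet k → Fin k × Fin k → Bool
links S T (x , y) = (S x ∧ T y) ∨ (T x ∧ S y)

-- An identity between functions of four Booleans is proved by evaluating both
-- sides on all 16 inputs; ∀ᵇ p checks p on both Booleans.
∀ᵇ : (Bool → Bool) → Bool
∀ᵇ p = p false ∧ p true

∀ᵇ-sound : (p : Bool → Bool) → T (∀ᵇ p) → ∀ b → T (p b)
∀ᵇ-sound p t false = proj₁ (Equivalence.to T-∧ t)
∀ᵇ-sound p t true  = proj₂ (Equivalence.to T-∧ t)

by-truth-table : (f g : Bool → Bool → Bool → Bool → ℕ) →
  T (∀ᵇ λ a → ∀ᵇ λ b → ∀ᵇ λ c → ∀ᵇ λ d → f a b c d ≡ᵇ g a b c d) →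
  ∀ a b c d → f a b c d ≡ g a b c d
by-truth-table f g table a b c d =
  ≡ᵇ⇒≡ _ _ (∀ᵇ-sound (λ d → f a b c d ≡ᵇ g a b c d)
    (∀ᵇ-sound (λ c → ∀ᵇ λ d → f a b c d ≡ᵇ g a b c d)
      (∀ᵇ-sound (λ b → ∀ᵇ λ c → ∀ᵇ λ d → f a b c d ≡ᵇ g a b c d)
        (∀ᵇ-sound (λ a → ∀ᵇ λ b → ∀ᵇ λ c → ∀ᵇ λ d → f a b c d ≡ᵇ g a b c d) table a) b) c) d)

∑-mono-≤ : {f g : Fin m → ℕ} → (∀ i → f i ≤ g i) → sum f ≤ sum g
∑-mono-≤ {zero}  f≤g = z≤n
∑-mono-≤ {suc m} f≤g = +-mono-≤ (f≤g zero) (∑-mono-≤ (f≤g ∘ suc))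

at : Fin m → (Fin m → ℕ) → Fin m → ℕ
at j f i = if does (i ≟ j) then f i else 0

∑-at : (j : Fin m) (f : Fin m → ℕ) → sum (at j f) ≡ f j
∑-at {suc m} zero    f = trans (cong (f zero +_) (sum-replicate-zero m)) (+-identityʳ (f zero))
∑-at {suc m} (suc j) f = ∑-at j (f ∘ suc)

term≤∑ : (f : Fin m → ℕ) (j : Fin m) → f j ≤ sum f
term≤∑ f j = subst (_≤ sum f) (∑-at j f) (∑-mono-≤ at≤)
  where
  at≤ : ∀ i → at j f i ≤ f i
  at≤ i with does (i ≟ j)
  ... | true  = ≤-refl
  ... | false = z≤n

outside : Fin m → Fin m → Fin m → Bool
outside a b i = not (⌊ i ≟ a ⌋ ∨ ⌊ i ≟ b ⌋)

∑-outside : Fin m → Fin m → (Fin m → ℕ) → ℕ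
∑-outside a b f = sum (λ i → if outside a b i then f i else 0)

∑-split₂ : {a b : Fin m} → a ≢ b → (f : Fin m → ℕ) → sum f ≡ ∑-outside a b f + (f a + f b)
∑-split₂ {a = a} {b} a≢b f = begin
  sum f                                                   ≡⟨ sum-cong-≗ pointwise ⟩
  sum (λ i → (if outside a b i then f i else 0) + (at a f i + at b f i))
    ≡⟨ ∑-distrib-+ (λ i → if outside a b i then f i else 0) (λ i → at a f i + at b f i) ⟩
  ∑-outside a b f + sum (λ i → at a f i + at b f i)       ≡⟨ cong (∑-outside a b f +_) (∑-distrib-+ (at a f) (at b f)) ⟩
  ∑-outside a b f + (sum (at a f) + sum (at b f))         ≡⟨ cong (∑-outside a b f +_) (cong₂ _+_ (∑-at a f) (∑-at b f)) ⟩
  ∑-outside a b f + (f a + f b)                           ∎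
  where
  open ≡-Reasoning
  pointwise : ∀ i → f i ≡ (if outside a b i then f i else 0) + (at a f i + at b f i)
  pointwise i with i ≟ a | i ≟ b
  ... | yes refl | yes refl = contradiction refl a≢b
  ... | yes refl | no  _    = sym (+-identityʳ (f i))
  ... | no  _    | yes refl = refl
  ... | no  _    | no  _    = sym (+-identityʳ (f i))

∑-split₁ : (a : Fin m) (f : Fin m → ℕ) → sum f ≡ ∑-outside a a f + f a
∑-split₁ a f = begin
  sum f                                                              ≡⟨ sum-cong-≗ pointwise ⟩
  sum (λ i → (if outside a a i then f i else 0) + at a f i)          ≡⟨ ∑-distrib-+ (λ i → if outside a a i then f i else 0) (at a f) ⟩
  ∑-outside a a f + sum (at a f)                                     ≡⟨ cong (∑-outside a a f +_) (∑-at a f) ⟩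
  ∑-outside a a f + f a                                              ∎
  where
  open ≡-Reasoning
  pointwise : ∀ i → f i ≡ (if outside a a i then f i else 0) + at a f i
  pointwise i with i ≟ a
  ... | yes _ = refl
  ... | no  _ = sym (+-identityʳ (f i))

three-terms≤∑ : (f : Fin m → ℕ) {a b c : Fin m} → a ≢ b → b ≢ c → a ≢ c → f a + f b + f c ≤ sum f
three-terms≤∑ f {a} {b} {c} a≢b b≢c a≢c = begin
  f a + f b + f c                    ≡⟨ +-comm (f a + f b) (f c) ⟩
  f c + (f a + f b)                  ≤⟨ +-monoˡ-≤ (f a + f b) (subst (_≤ ∑-outside a b f) c-outside (term≤∑ _ c)) ⟩
  ∑-outside a b f + (f a + f b)      ≡⟨ ∑-split₂ a≢b f ⟨
  sum f                              ∎
  where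
  open ≤-Reasoning
  c-outside : (if outside a b c then f c else 0) ≡ f c
  c-outside with c ≟ a | c ≟ b
  ... | yes c≡a | _       = contradiction (sym c≡a) a≢c
  ... | no  _   | yes c≡b = contradiction (sym c≡b) b≢c
  ... | no  _   | no  _   = refl

∑-lift₂₂ : {f g h j l : Fin m → ℕ} → (∀ i → f i + g i ≡ h i + j i + 2 * l i) →
  sum f + sum g ≡ sum h + sum j + 2 * sum l
∑-lift₂₂ {f = f} {g} {h} {j} {l} eq = begin
  sum f + sum g                                  ≡⟨ ∑-distrib-+ f g ⟨
  sum (λ i → f i + g i)                          ≡⟨ sum-cong-≗ eq ⟩
  sum (λ i → h i + j i + 2 * l i)                ≡⟨ ∑-distrib-+ (λ i → h i + j i) (λ i → 2 * l i) ⟩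
  sum (λ i → h i + j i) + sum (λ i → 2 * l i)    ≡⟨ cong₂ _+_ (∑-distrib-+ h j) (sym (*-distribˡ-sum 2 l)) ⟩
  sum h + sum j + 2 * sum l                      ∎
  where open ≡-Reasoning

∑-lift₁₂ : {f h j l : Fin m → ℕ} → (∀ i → f i + 2 * l i ≡ h i + j i) →
  sum f + 2 * sum l ≡ sum h + sum j
∑-lift₁₂ {f = f} {h} {j} {l} eq = begin
  sum f + 2 * sum l                  ≡⟨ cong (sum f +_) (*-distribˡ-sum 2 l) ⟩
  sum f + sum (λ i → 2 * l i)        ≡⟨ ∑-distrib-+ f (λ i → 2 * l i) ⟨
  sum (λ i → f i + 2 * l i)          ≡⟨ sum-cong-≗ eq ⟩
  sum (λ i → h i + j i)              ≡⟨ ∑-distrib-+ h j ⟩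
  sum h + sum j                      ∎
  where open ≡-Reasoning

count-∷ : (p : P → Bool) (x : P) (xs : List P) →
  length (filterᵇ p (x ∷ xs)) ≡ 𝟙 (p x) + length (filterᵇ p xs)
count-∷ p x xs with p x
... | true  = refl
... | false = refl

count-tabulate : (p : P → Bool) (g : Fin m → P) → length (filterᵇ p (tabulate g)) ≡ sum (λ i → 𝟙 (p (g i)))
count-tabulate {m = zero}  p g = refl
count-tabulate {m = suc m} p g =
  trans (count-∷ p (g zero) (tabulate (g ∘ suc))) (cong (𝟙 (p (g zero)) +_) (count-tabulate p (g ∘ suc)))

count-kept : (p : Q → Bool) (f : P → Q) (keep : P → Bool) (g : Fin m → P) →
  length (filterᵇ p (map f (filterᵇ keep (tabulate g)))) ≡ sum (λ i → if keep (g i) then 𝟙 (p (f (g i))) else 0)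
count-kept {m = zero}  p f keep g = refl
count-kept {m = suc m} p f keep g with keep (g zero)
... | true  = trans (count-∷ p (f (g zero)) _) (cong (𝟙 (p (f (g zero))) +_) (count-kept p f keep (g ∘ suc)))
... | false = count-kept p f keep (g ∘ suc)

count-halfEdges : (p : P × Bool → Bool) (g : Fin m → P) →
  length (filterᵇ p (cartesianProduct (tabulate g) (true ∷ false ∷ [])))
    ≡ sum (λ i → 𝟙 (p (g i , true)) + 𝟙 (p (g i , false)))
count-halfEdges {m = zero}  p g = refl
count-halfEdges {P = P} {m = suc m} p g = begin
  length (filterᵇ p ((g zero , true) ∷ (g zero , false) ∷ rest))  ≡⟨ count-∷ p _ _ ⟩
  𝟙 t + length (filterᵇ p ((g zero , false) ∷ rest))               ≡⟨ cong (𝟙 t +_) (count-∷ p _ _) ⟩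
  𝟙 t + (𝟙 f + length (filterᵇ p rest))                             ≡⟨ +-assoc (𝟙 t) (𝟙 f) _ ⟨
  𝟙 t + 𝟙 f + length (filterᵇ p rest)                               ≡⟨ cong (𝟙 t + 𝟙 f +_) (count-halfEdges p (g ∘ suc)) ⟩
  𝟙 t + 𝟙 f + sum (λ i → 𝟙 (p (g (suc i) , true)) + 𝟙 (p (g (suc i) , false)))  ∎
  where
  open ≡-Reasoning
  rest : List (P × Bool)
  rest = cartesianProduct (tabulate (g ∘ suc)) (true ∷ false ∷ [])
  t f : Bool
  t = p (g zero , true)
  f = p (g zero , false)

E : (G : Graph) → EdgeIx G → Fin (n G) × Fin (n G)
E G i = lookup (edges G) i

cut : (G : Graph) → VSet (n G) → ℕ
cut G A = sum (λ i → 𝟙 (crosses A (E G i)))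

cutSize≡cut : (G : Graph) (A : VSet (n G)) → cutSize G A ≡ cut G A
cutSize≡cut G A = begin
  length (filterᵇ (crosses A) (edges G))                        ≡⟨ cong (length ∘ filterᵇ (crosses A)) (tabulate-lookup (edges G)) ⟨
  length (filterᵇ (crosses A) (tabulate (lookup (edges G))))    ≡⟨ count-tabulate (crosses A) (lookup (edges G)) ⟩
  cut G A                                                       ∎
  where open ≡-Reasoning

degree≡∑ : (G : Graph) (v : Fin (n G)) →
  degree G v ≡ sum (λ i → 𝟙 (⟨ v ⟩ (proj₁ (E G i))) + 𝟙 (⟨ v ⟩ (proj₂ (E G i))))
degree≡∑ G v = count-halfEdges (λ h → ⌊ end G h ≟ v ⌋) (λ i → i)

cut-≗ : (G : Graph) (A B : VSet (n G)) → (∀ e → crosses A e ≡ crosses B e) → cut G A ≡ cut G B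
cut-≗ G A B eq = sum-cong-≗ (λ i → cong 𝟙 (eq (E G i)))

cut-cong : (G : Graph) {A B : VSet (n G)} → (∀ u → A u ≡ B u) → cut G A ≡ cut G B
cut-cong G {A} {B} A≗B = cut-≗ G A B (λ (x , y) → cong₂ _≠ᵇ_ (A≗B x) (A≗B y))

cut-∁ : (G : Graph) (A : VSet (n G)) → cut G (∁ A) ≡ cut G A
cut-∁ G A = cut-≗ G (∁ A) A (λ (x , y) → ≠ᵇ-not (A x) (A y))

cutSize-split : (G : Graph) (h₁ h₂ : HalfEdge G) (A' : VSet (suc (n G))) →
  cutSize (split G h₁ h₂) A'
    ≡ ∑-outside (proj₁ h₁) (proj₁ h₂) (λ i → 𝟙 (crosses (A' ∘ inject₁) (E G i)))
      + (𝟙 (A' (fromℕ (n G)) ≠ᵇ A' (inject₁ (other G h₁))) + 𝟙 (A' (fromℕ (n G)) ≠ᵇ A' (inject₁ (other G h₂))))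
cutSize-split G h₁ h₂ A' = begin
  length (filterᵇ (crosses A') (kept ++ new))                              ≡⟨ cong length (filter-++ (T? ∘ crosses A') kept new) ⟩
  length (filterᵇ (crosses A') kept ++ filterᵇ (crosses A') new)           ≡⟨ length-++ (filterᵇ (crosses A') kept) ⟩
  length (filterᵇ (crosses A') kept) + length (filterᵇ (crosses A') new)   ≡⟨ cong₂ _+_ (count-kept (crosses A') lift keep (λ i → i)) count-new ⟩
  ∑-outside (proj₁ h₁) (proj₁ h₂) (λ i → 𝟙 (crosses A (E G i))) + (𝟙 (A' w ≠ᵇ A (other G h₁)) + 𝟙 (A' w ≠ᵇ A (other G h₂)))  ∎
  where
  open ≡-Reasoning
  A : VSet (n G)
  A = A' ∘ inject₁
  w : Fin (suc (n G))
  w = fromℕ (n G)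
  lift : EdgeIx G → Fin (suc (n G)) × Fin (suc (n G))
  lift i = inject₁ (proj₁ (E G i)) , inject₁ (proj₂ (E G i))
  keep : EdgeIx G → Bool
  keep = outside (proj₁ h₁) (proj₁ h₂)
  kept new : List (Fin (suc (n G)) × Fin (suc (n G)))
  kept = map lift (filterᵇ keep (allFin (length (edges G))))
  new = (w , inject₁ (other G h₁)) ∷ (w , inject₁ (other G h₂)) ∷ []
  count-new : length (filterᵇ (crosses A') new)
            ≡ 𝟙 (A' w ≠ᵇ A' (inject₁ (other G h₁))) + 𝟙 (A' w ≠ᵇ A' (inject₁ (other G h₂)))
  count-new = trans (count-∷ (crosses A') _ _) (cong (𝟙 (crosses A' (w , inject₁ (other G h₁))) +_)
                (trans (count-∷ (crosses A') _ []) (+-identityʳ _)))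

crosses-halfEdge : (G : Graph) (A : VSet (n G)) (h : HalfEdge G) →
  crosses A (E G (proj₁ h)) ≡ A (end G h) ≠ᵇ A (other G h)
crosses-halfEdge G A (i , true)  = refl
crosses-halfEdge G A (i , false) = ≠ᵇ-sym (A (proj₁ (E G i))) (A (proj₂ (E G i)))

links-halfEdge : (G : Graph) (S T : VSet (n G)) (h : HalfEdge G) →
  S (end G h) ≡ true → T (other G h) ≡ true → links S T (E G (proj₁ h)) ≡ true
links-halfEdge G S T (i , true)  S∋end T∋other =
  cong₂ (λ s t → (s ∧ t) ∨ (T (proj₁ (E G i)) ∧ S (proj₂ (E G i)))) S∋end T∋other
links-halfEdge G S T (i , false) S∋end T∋other =
  trans (cong₂ (λ t s → (S (proj₁ (E G i)) ∧ T (proj₂ (E G i))) ∨ (t ∧ s)) T∋other S∋end) (∨-zeroʳ _)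

same-edge⇒loop : (G : Graph) {v : Fin (n G)} (h h' : HalfEdge G) →
  h ≢ h' → proj₁ h ≡ proj₁ h' → end G h' ≡ v → other G h ≡ v
same-edge⇒loop G (i , true)  (.i , true)  h≢h' refl _  = contradiction refl h≢h'
same-edge⇒loop G (i , true)  (.i , false) _    refl at = at
same-edge⇒loop G (i , false) (.i , true)  _    refl at = at
same-edge⇒loop G (i , false) (.i , false) h≢h' refl _  = contradiction refl h≢h'

between : (G : Graph) → VSet (n G) → VSet (n G) → ℕ
between G S T = sum (λ i → 𝟙 (links S T (E G i)))

-- A single edge, viewed as the two-vertex graph 0 — 1; a ▹ b is the vertex set
-- containing its first end iff a and its second end iff b.  An identity on this
-- edge, checked by truth table, holds on every edge (x , y) of every graph, with
-- a = X x, b = X y, c = Y x, d = Y y; summing over the edges gives a cut identity.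
_▹_ : Bool → Bool → VSet 2
(a ▹ b) zero    = a
(a ▹ b) (suc _) = b

e₀ : Fin 2 × Fin 2
e₀ = zero , suc zero

∩∪-on-an-edge : ∀ a b c d → let X = a ▹ b ; Y = c ▹ d in
  𝟙 (crosses X e₀) + 𝟙 (crosses Y e₀)
    ≡ 𝟙 (crosses (X ∩ Y) e₀) + 𝟙 (crosses (X ∪ Y) e₀) + 2 * 𝟙 (links (X ∖ Y) (Y ∖ X) e₀)
∩∪-on-an-edge = by-truth-table _ _ tt

∖-on-an-edge : ∀ a b c d → let X = a ▹ b ; Y = c ▹ d in
  𝟙 (crosses X e₀) + 𝟙 (crosses Y e₀)
    ≡ 𝟙 (crosses (X ∖ Y) e₀) + 𝟙 (crosses (Y ∖ X) e₀) + 2 * 𝟙 (links (∁ (X ∪ Y)) (X ∩ Y) e₀)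
∖-on-an-edge = by-truth-table _ _ tt

partition-on-an-edge : ∀ a b c d → let X = a ▹ b ; Y = c ▹ d in
  𝟙 (crosses X e₀) + 2 * 𝟙 (links (X ∩ Y) (X ∖ Y) e₀) ≡ 𝟙 (crosses (X ∩ Y) e₀) + 𝟙 (crosses (X ∖ Y) e₀)
partition-on-an-edge = by-truth-table _ _ tt

uncross-∩∪ : (G : Graph) (X Y : VSet (n G)) →
  cut G X + cut G Y ≡ cut G (X ∩ Y) + cut G (X ∪ Y) + 2 * between G (X ∖ Y) (Y ∖ X)
uncross-∩∪ G X Y = ∑-lift₂₂ λ i → let (x , y) = E G i in ∩∪-on-an-edge (X x) (X y) (Y x) (Y y)

uncross-∖ : (G : Graph) (X Y : VSet (n G)) →
  cut G X + cut G Y ≡ cut G (X ∖ Y) + cut G (Y ∖ X) + 2 * between G (∁ (X ∪ Y)) (X ∩ Y)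
uncross-∖ G X Y = ∑-lift₂₂ λ i → let (x , y) = E G i in ∖-on-an-edge (X x) (X y) (Y x) (Y y)

cut-partition : (G : Graph) (X Y : VSet (n G)) →
  cut G X + 2 * between G (X ∩ Y) (X ∖ Y) ≡ cut G (X ∩ Y) + cut G (X ∖ Y)
cut-partition G X Y = ∑-lift₁₂ λ i → let (x , y) = E G i in partition-on-an-edge (X x) (X y) (Y x) (Y y)

add-vertex-on-an-edge : {v : Fin k} (Z : VSet k) → Z v ≡ false → (x y : Fin k) →
  𝟙 (crosses (⟨ v ⟩ ∪ Z) (x , y)) + 2 * 𝟙 (links ⟨ v ⟩ (⟨ v ⟩ ∪ Z) (x , y))
    ≡ 𝟙 (crosses Z (x , y)) + (𝟙 (⟨ v ⟩ x) + 𝟙 (⟨ v ⟩ y))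
add-vertex-on-an-edge {v = v} Z Z∌v x y with x ≟ v | y ≟ v
add-vertex-on-an-edge Z Z∌v x y | yes refl | yes refl rewrite Z∌v = refl
add-vertex-on-an-edge Z Z∌v x y | yes refl | no  _    rewrite Z∌v with Z y
...   | false = refl
...   | true  = refl
add-vertex-on-an-edge Z Z∌v x y | no  _    | yes refl rewrite Z∌v with Z x
...   | false = refl
...   | true  = refl
add-vertex-on-an-edge Z Z∌v x y | no  _    | no  _    with Z x
...   | false = refl
...   | true  = refl

add-vertex : (G : Graph) {v : Fin (n G)} (Z : VSet (n G)) → Z v ≡ false →
  cut G (⟨ v ⟩ ∪ Z) + 2 * between G ⟨ v ⟩ (⟨ v ⟩ ∪ Z) ≡ cut G Z + degree G v
add-vertex G {v} Z Z∌v =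
  trans (∑-lift₁₂ (λ i → add-vertex-on-an-edge Z Z∌v (proj₁ (E G i)) (proj₂ (E G i))))
        (cong (cut G Z +_) (sym (degree≡∑ G v)))

Odd Even : ℕ → Set
Odd  k = k % 2 ≡ 1
Even k = k % 2 ≡ 0

OddBounded : ℕ → Set
OddBounded k = Odd k → 5 ≤ k

oddBounded : (G : Graph) → FiveOddConnected G → (A : VSet (n G)) → OddBounded (cut G A)
oddBounded G foc A = subst OddBounded (cutSize≡cut G A) (foc A)

even-or-odd : ∀ k → Even k ⊎ Odd k
even-or-odd k with k % 2 | m%n<n k 2
... | 0           | _                 = inj₁ refl
... | 1           | _                 = inj₂ refl
... | suc (suc _) | s≤s (s≤s ())

parity-+ : ∀ a b {pa pb} → a % 2 ≡ pa → b % 2 ≡ pb → (a + b) % 2 ≡ (pa + pb) % 2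
parity-+ a b refl refl = %-distribˡ-+ a b 2

parity-+2* : ∀ a j → (a + 2 * j) % 2 ≡ a % 2
parity-+2* a j = trans (cong (λ t → (a + t) % 2) (*-comm 2 j)) ([m+kn]%n≡m%n a j 2)

odd-partner : ∀ a b → Even (a + b) → Odd a → Odd b
odd-partner a b a+b-even a-odd with even-or-odd b
... | inj₂ b-odd  = b-odd
... | inj₁ b-even = contradiction (trans (sym a+b-even) (parity-+ a b a-odd b-even)) λ ()

odd-partner′ : ∀ a b → Odd (a + b) → Even a → Odd b
odd-partner′ a b a+b-odd a-even with even-or-odd b
... | inj₂ b-odd  = b-odd
... | inj₁ b-even = contradiction (trans (sym a+b-odd) (parity-+ a b a-even b-even)) λ ()

odd-gap : ∀ {k} → Odd k → 5 ≤ k → k ≢ 5 → 7 ≤ k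
odd-gap k-odd 5≤k k≢5 = ≤∧≢⇒< (≤∧≢⇒< 5≤k (k≢5 ∘ sym)) λ 6≡k → contradiction (subst Odd (sym 6≡k) k-odd) λ ()

2+n≰n : ∀ {k} → ¬ 2 + k ≤ k
2+n≰n 2+k≤k = 1+n≰n (≤-trans (n≤1+n _) 2+k≤k)

flip₂ : ∀ K t₁ t₂ → OddBounded (K + (𝟙 t₁ + 𝟙 t₂)) → (K + (𝟙 t₁ + 𝟙 t₂) ≡ 5 → t₁ ≡ true → t₂ ≡ true → ⊥) →
  OddBounded (K + (𝟙 (not t₁) + 𝟙 (not t₂)))
flip₂ K true  false bound _ = bound
flip₂ K false true  bound _ = bound
flip₂ K true  true  bound not-five K+0-odd =
  subst (5 ≤_) (sym (+-identityʳ K)) (+-cancelʳ-≤ 2 5 K (odd-gap K+2-odd (bound K+2-odd) (λ eq → not-five eq refl refl)))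
  where
  K+2-odd : Odd (K + 2)
  K+2-odd = trans (parity-+2* K 1) (trans (cong (_% 2) (sym (+-identityʳ K))) K+0-odd)
flip₂ K false false bound _ K+2-odd = ≤-trans (bound K+0-odd) (+-monoʳ-≤ K z≤n)
  where
  K+0-odd : Odd (K + 0)
  K+0-odd = trans (cong (_% 2) (+-identityʳ K)) (trans (sym (parity-+2* K 1)) K+2-odd)

-- Reattaching a vertex with two edges (to sides b₁, b₂) from side c to side a, the
-- rest K of the cut being unchanged, preserves odd-boundedness unless the old
-- cut was a 5-cut crossed by both edges.
reattach : ∀ K a c b₁ b₂ → OddBounded (K + (𝟙 (c ≠ᵇ b₁) + 𝟙 (c ≠ᵇ b₂))) →
  (K + (𝟙 (c ≠ᵇ b₁) + 𝟙 (c ≠ᵇ b₂)) ≡ 5 → c ≠ᵇ b₁ ≡ true → c ≠ᵇ b₂ ≡ true → ⊥) →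
  OddBounded (K + (𝟙 (a ≠ᵇ b₁) + 𝟙 (a ≠ᵇ b₂)))
reattach K a c b₁ b₂ bound not-five with a Bool.≟ c
... | yes refl = bound
... | no  a≢c rewrite ¬-not a≢c | ≠ᵇ-notˡ c b₁ | ≠ᵇ-notˡ c b₂ = flip₂ K (c ≠ᵇ b₁) (c ≠ᵇ b₂) bound not-five

IsTight : (G : Graph) → Fin (n G) → Fin (n G) → Fin (n G) → VSet (n G) → Set
IsTight G v v₁ v₂ X = cut G X ≡ 5 × X v ≡ false × X v₁ ≡ true × X v₂ ≡ true

Tight : (G : Graph) → Fin (n G) → Fin (n G) → Fin (n G) → Set
Tight G v v₁ v₂ = Σ (VSet (n G)) (IsTight G v v₁ v₂)

isTight? : (G : Graph) (v v₁ v₂ : Fin (n G)) (X : VSet (n G)) → Dec (IsTight G v v₁ v₂ X)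
isTight? G v v₁ v₂ X = (cut G X ℕ.≟ 5) ×-dec (X v Bool.≟ false) ×-dec (X v₁ Bool.≟ true) ×-dec (X v₂ Bool.≟ true)

IsTight-cong : (G : Graph) {v v₁ v₂ : Fin (n G)} {X Y : VSet (n G)} → (∀ u → X u ≡ Y u) →
  IsTight G v v₁ v₂ X → IsTight G v v₁ v₂ Y
IsTight-cong G {v} {v₁} {v₂} X≗Y (cut₅ , v∉ , v₁∈ , v₂∈) =
  trans (sym (cut-cong G X≗Y)) cut₅ , trans (sym (X≗Y v)) v∉ , trans (sym (X≗Y v₁)) v₁∈ , trans (sym (X≗Y v₂)) v₂∈

tight? : (G : Graph) (v v₁ v₂ : Fin (n G)) → Dec (Tight G v v₁ v₂)
tight? G v v₁ v₂ with anySubset? (isTight? G v v₁ v₂ ∘ Vec.lookup)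
... | yes (s , tight) = yes (Vec.lookup s , tight)
... | no  none        = no λ (X , tight) → none (Vec.tabulate X , IsTight-cong G (sym ∘ lookup∘tabulate X) tight)

-- A 5-cut that separates v from both v₁ and v₂ gives a tight set: its side avoiding v.
tight-from-cut : (G : Graph) {v v₁ v₂ : Fin (n G)} (A : VSet (n G)) → cut G A ≡ 5 →
  A v ≠ᵇ A v₁ ≡ true → A v ≠ᵇ A v₂ ≡ true → Tight G v v₁ v₂
tight-from-cut G {v} {v₁} {v₂} A cut₅ sep₁ sep₂ with A v in A-v
... | false = A , cut₅ , A-v , sep₁ , sep₂
... | true  = ∁ A , trans (cut-∁ G A) cut₅ , cong not A-v ,
              trans (sym (∨-identityʳ (not (A v₁)))) sep₁ , trans (sym (∨-identityʳ (not (A v₂)))) sep₂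

-- In G, the cut of A consists of the edges other than those of h₁, h₂ together
-- with the crossings along h₁ and h₂.  (If h₁, h₂ are the two ends of a loop at
-- v, both sides count the loop zero times.)
cut-around : (G : Graph) {v : Fin (n G)} (A : VSet (n G)) (h₁ h₂ : HalfEdge G) →
  h₁ ≢ h₂ → end G h₁ ≡ v → end G h₂ ≡ v →
  cut G A ≡ ∑-outside (proj₁ h₁) (proj₁ h₂) (λ i → 𝟙 (crosses A (E G i)))
              + (𝟙 (A v ≠ᵇ A (other G h₁)) + 𝟙 (A v ≠ᵇ A (other G h₂)))
cut-around G {v} A h₁ h₂ h₁≢h₂ at₁ at₂ with proj₁ h₁ ≟ proj₁ h₂
... | no  distinct = trans (∑-split₂ distinct crossing) (cong (K +_) (cong₂ _+_ (along h₁ at₁) (along h₂ at₂)))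
  where
  crossing : EdgeIx G → ℕ
  crossing i = 𝟙 (crosses A (E G i))
  K : ℕ
  K = ∑-outside (proj₁ h₁) (proj₁ h₂) crossing
  along : (h : HalfEdge G) → end G h ≡ v → crossing (proj₁ h) ≡ 𝟙 (A v ≠ᵇ A (other G h))
  along h refl = cong 𝟙 (crosses-halfEdge G A h)
... | yes same = begin
  cut G A                                                 ≡⟨ ∑-split₁ (proj₁ h₁) crossing ⟩
  K₁ + crossing (proj₁ h₁)                                ≡⟨ cong₂ (λ j b → ∑-outside (proj₁ h₁) j crossing + 𝟙 b) same loop-crossing ⟩
  K + 𝟙 (A v ≠ᵇ A v)                                      ≡⟨ cong (λ b → K + 𝟙 b) (≠ᵇ-self (A v)) ⟩
  K + (0 + 0)                                             ≡⟨ cong (λ b → K + (𝟙 b + 𝟙 b)) (≠ᵇ-self (A v)) ⟨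
  K + (𝟙 (A v ≠ᵇ A v) + 𝟙 (A v ≠ᵇ A v))                  ≡⟨ cong₂ (λ u w → K + (𝟙 (A v ≠ᵇ A u) + 𝟙 (A v ≠ᵇ A w))) loop₁ loop₂ ⟨
  K + (𝟙 (A v ≠ᵇ A (other G h₁)) + 𝟙 (A v ≠ᵇ A (other G h₂)))  ∎
  where
  open ≡-Reasoning
  crossing : EdgeIx G → ℕ
  crossing i = 𝟙 (crosses A (E G i))
  K₁ K : ℕ
  K₁ = ∑-outside (proj₁ h₁) (proj₁ h₁) crossing
  K = ∑-outside (proj₁ h₁) (proj₁ h₂) crossing
  loop₁ : other G h₁ ≡ v
  loop₁ = same-edge⇒loop G h₁ h₂ h₁≢h₂ same at₂
  loop₂ : other G h₂ ≡ v
  loop₂ = same-edge⇒loop G h₂ h₁ (h₁≢h₂ ∘ sym) (sym same) at₁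
  loop-crossing : crosses A (E G (proj₁ h₁)) ≡ A v ≠ᵇ A v
  loop-crossing = trans (crosses-halfEdge G A h₁) (cong₂ (λ u w → A u ≠ᵇ A w) at₁ loop₁)

split-preserves : (G : Graph) → FiveOddConnected G → {v : Fin (n G)} (h₁ h₂ : HalfEdge G) →
  h₁ ≢ h₂ → end G h₁ ≡ v → end G h₂ ≡ v → ¬ Tight G v (other G h₁) (other G h₂) →
  FiveOddConnected (split G h₁ h₂)
split-preserves G foc {v} h₁ h₂ h₁≢h₂ at₁ at₂ no-tight A' =
  subst OddBounded (sym (cutSize-split G h₁ h₂ A'))
    (reattach K (A' (fromℕ (n G))) (A v) (A (other G h₁)) (A (other G h₂))
      (subst OddBounded cut-A (oddBounded G foc A))
      (λ five sep₁ sep₂ → no-tight (tight-from-cut G A (trans cut-A five) sep₁ sep₂)))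
  where
  A : VSet (n G)
  A = A' ∘ inject₁
  K : ℕ
  K = ∑-outside (proj₁ h₁) (proj₁ h₂) (λ i → 𝟙 (crosses A (E G i)))
  cut-A : cut G A ≡ K + (𝟙 (A v ≠ᵇ A (other G h₁)) + 𝟙 (A v ≠ᵇ A (other G h₂)))
  cut-A = cut-around G A h₁ h₂ h₁≢h₂ at₁ at₂

-- With d(X) = d(Y) = 5, p = d(X ∩ Y), q = d(X ∪ Y),
-- r = d(X ∖ Y), s = d(Y ∖ X), z = d(X ∪ Y + v), the uncrossing identities and
-- the bounds J ≥ 3, D₂ ≥ 1 contradict the odd-cut condition for p, q, r, s, z.
uncrossing-arithmetic : ∀ {x y p q r s z D₁ D₂ T₃ T₄ J} → x ≡ 5 → y ≡ 5 →
  x + y ≡ p + q + 2 * D₁ → x + y ≡ r + s + 2 * D₂ → x + 2 * T₃ ≡ p + r → y + 2 * T₄ ≡ p + s →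
  z + 2 * J ≡ q + 4 → 3 ≤ J → 1 ≤ D₂ →
  OddBounded p → OddBounded q → OddBounded r → OddBounded s → OddBounded z → ⊥
uncrossing-arithmetic {p = p} {q} {r} {s} {z} {D₁} {D₂} {T₃} {T₄} {J}
  refl refl ∩∪ ∖∖ X-parts Y-parts add-v 3≤J 1≤D₂ p-ok q-ok r-ok s-ok z-ok with even-or-odd p
... | inj₂ p-odd = 2+n≰n (begin
  5 + 2 * 3    ≤⟨ +-mono-≤ (z-ok z-odd) (*-monoʳ-≤ 2 3≤J) ⟩
  z + 2 * J    ≡⟨ add-v ⟩
  q + 4        ≤⟨ +-monoˡ-≤ 4 q≤5 ⟩
  9            ∎)
  where
  -- d(X ∪ Y) is odd and at most 5, hence d(X ∪ Y + v) is odd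
  open ≤-Reasoning
  q-odd : Odd q
  q-odd = odd-partner p q (trans (sym (parity-+2* (p + q) D₁)) (cong (_% 2) (sym ∩∪))) p-odd
  q≤5 : q ≤ 5
  q≤5 = +-cancelˡ-≤ 5 q 5 (≤-trans (+-monoˡ-≤ q (p-ok p-odd)) (subst (p + q ≤_) (sym ∩∪) (m≤m+n (p + q) (2 * D₁))))
  z-odd : Odd z
  z-odd = trans (sym (parity-+2* z J)) (trans (cong (_% 2) add-v) (trans (parity-+2* q 2) q-odd))
... | inj₁ p-even = 2+n≰n (begin
  5 + 5 + 2 * 1    ≤⟨ +-mono-≤ (+-mono-≤ (r-ok r-odd) (s-ok s-odd)) (*-monoʳ-≤ 2 1≤D₂) ⟩
  r + s + 2 * D₂   ≡⟨ ∖∖ ⟨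
  10               ∎)
  where
  open ≤-Reasoning
  r-odd : Odd r
  r-odd = odd-partner′ p r (trans (cong (_% 2) (sym X-parts)) (parity-+2* 5 T₃)) p-even
  s-odd : Odd s
  s-odd = odd-partner′ p s (trans (cong (_% 2) (sym Y-parts)) (parity-+2* 5 T₄)) p-even

distinct-edges : (G : Graph) {v : Fin (n G)} (S : VSet (n G)) (h h' : HalfEdge G) → S v ≡ false →
  S (other G h) ≡ true → h ≢ h' → end G h' ≡ v → proj₁ h ≢ proj₁ h'
distinct-edges G S h h' S∌v S∋other h≢h' at' same =
  contradiction (trans (sym S∋other) (trans (cong S (same-edge⇒loop G h h' h≢h' same at')) S∌v)) λ ()

∈⟨⟩ : {u v : Fin k} → u ≡ v → ⟨ v ⟩ u ≡ true
∈⟨⟩ {u = u} {v} u≡v with u ≟ v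
... | yes _   = refl
... | no  u≢v = contradiction u≡v u≢v

∈∪ˡ : (S T : VSet k) {u : Fin k} → S u ≡ true → (S ∪ T) u ≡ true
∈∪ˡ S T {u} S∋u = cong (_∨ T u) S∋u

∈∪ʳ : (S T : VSet k) {u : Fin k} → T u ≡ true → (S ∪ T) u ≡ true
∈∪ʳ S T {u} T∋u = trans (cong (S u ∨_) T∋u) (∨-zeroʳ (S u))

no-consecutive-tight : (G : Graph) → FiveOddConnected G → {v : Fin (n G)} → degree G v ≡ 4 →
  (h : Fin 4 → HalfEdge G) → Injective _≡_ _≡_ h → ((i : Fin 4) → end G (h i) ≡ v) →
  Tight G v (other G (h zero)) (other G (h (suc zero))) →
  ¬ Tight G v (other G (h (suc zero))) (other G (h (suc (suc zero))))
no-consecutive-tight G foc {v} deg h inj at (X , cut-X , X∌v , X∋v₀ , X∋v₁) (Y , cut-Y , Y∌v , Y∋v₁ , Y∋v₂) =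
  uncrossing-arithmetic {D₁ = between G (X ∖ Y) (Y ∖ X)} {D₂ = between G (∁ (X ∪ Y)) (X ∩ Y)}
    {T₃ = between G (X ∩ Y) (X ∖ Y)} {T₄ = between G (Y ∩ X) (Y ∖ X)} {J = between G ⟨ v ⟩ (⟨ v ⟩ ∪ X ∪ Y)}
    cut-X cut-Y (uncross-∩∪ G X Y) (uncross-∖ G X Y) (cut-partition G X Y) Y-parts add-v 3≤J 1≤D₂
    (ok (X ∩ Y)) (ok (X ∪ Y)) (ok (X ∖ Y)) (ok (Y ∖ X)) (ok (⟨ v ⟩ ∪ X ∪ Y))
  where
  ok : (A : VSet (n G)) → OddBounded (cut G A)
  ok = oddBounded G foc
  h₀ h₁ h₂ : HalfEdge G
  h₀ = h zero
  h₁ = h (suc zero)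
  h₂ = h (suc (suc zero))
  at-v : (i : Fin 4) → ⟨ v ⟩ (end G (h i)) ≡ true
  at-v i = ∈⟨⟩ (at i)
  distinct : ∀ {i j} → i ≢ j → h i ≢ h j
  distinct i≢j = i≢j ∘ inj
  Y-parts : cut G Y + 2 * between G (Y ∩ X) (Y ∖ X) ≡ cut G (X ∩ Y) + cut G (Y ∖ X)
  Y-parts = trans (cut-partition G Y X) (cong (_+ cut G (Y ∖ X)) (cut-cong G (λ u → ∧-comm (Y u) (X u))))
  add-v : cut G (⟨ v ⟩ ∪ X ∪ Y) + 2 * between G ⟨ v ⟩ (⟨ v ⟩ ∪ X ∪ Y) ≡ cut G (X ∪ Y) + 4
  add-v = trans (add-vertex G (X ∪ Y) (cong₂ _∨_ X∌v Y∌v)) (cong (cut G (X ∪ Y) +_) deg)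
  -- h₀, h₁, h₂ lie on three distinct edges, each joining v to X ∪ Y
  joins : (i : Fin 4) → (X ∪ Y) (other G (h i)) ≡ true → 𝟙 (links ⟨ v ⟩ (⟨ v ⟩ ∪ X ∪ Y) (E G (proj₁ (h i)))) ≡ 1
  joins i into = cong 𝟙 (links-halfEdge G ⟨ v ⟩ (⟨ v ⟩ ∪ X ∪ Y) (h i) (at-v i) (∈∪ʳ ⟨ v ⟩ (X ∪ Y) into))
  3≤J : 3 ≤ between G ⟨ v ⟩ (⟨ v ⟩ ∪ X ∪ Y)
  3≤J = ≤-trans
    (≤-reflexive (sym (cong₂ _+_ (cong₂ _+_ (joins zero (∈∪ˡ X Y X∋v₀)) (joins (suc zero) (∈∪ˡ X Y X∋v₁)))
                                 (joins (suc (suc zero)) (∈∪ʳ X Y Y∋v₂)))))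
    (three-terms≤∑ _ (distinct-edges G X h₀ h₁ X∌v X∋v₀ (distinct λ ()) (at (suc zero)))
                     (distinct-edges G Y h₁ h₂ Y∌v Y∋v₁ (distinct λ ()) (at (suc (suc zero))))
                     (distinct-edges G X h₀ h₂ X∌v X∋v₀ (distinct λ ()) (at (suc (suc zero)))))
  -- h₁ joins v ∉ X ∪ Y to v₁ ∈ X ∩ Y
  1≤D₂ : 1 ≤ between G (∁ (X ∪ Y)) (X ∩ Y)
  1≤D₂ = ≤-trans
    (≤-reflexive (sym (cong 𝟙 (links-halfEdge G (∁ (X ∪ Y)) (X ∩ Y) h₁
      (trans (cong (∁ (X ∪ Y)) (at (suc zero))) (cong₂ (λ a b → not (a ∨ b)) X∌v Y∌v))
      (cong₂ _∧_ X∋v₁ Y∋v₁)))))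
    (term≤∑ _ (proj₁ h₁))

-- Either no set is tight for (v; v₀, v₁) and (A) applies to h₀, h₁, or there is
-- one, so by (B) none is tight for (v; v₁, v₂) and (A) applies to h₁, h₂.
lemma5 : (G : Graph) → FiveOddConnected G → (v : Fin (n G)) → degree G v ≡ 4
    → (h : Fin 4 → HalfEdge G) → Injective _≡_ _≡_ h → ((i : Fin 4) → end G (h i) ≡ v)
    → FiveOddConnected (split G (h zero) (h (suc zero)))
      ⊎ FiveOddConnected (split G (h (suc zero)) (h (suc (suc zero))))
lemma5 G foc v deg h inj at with tight? G v (other G (h zero)) (other G (h (suc zero)))
... | no  none     = inj₁ (split-preserves G foc (h zero) (h (suc zero)) (λ eq → case inj eq of λ ()) (at zero) (at (suc zero)) none)
... | yes tight₀₁ = inj₂ (split-preserves G foc (h (suc zero)) (h (suc (suc zero))) (λ eq → case inj eq of λ ())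
                           (at (suc zero)) (at (suc (suc zero))) (no-consecutive-tight G foc deg h inj at tight₀₁))
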